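{- Let $a\in\mathbb{F}_q^*$. Then the Hamming weights of the binary vectors $c_1(a)=(tr\frac{a}{\gamma_1},\ldots,tr\frac{a}{\gamma_{q/2-1}},tr\frac{a}{\gamma_1},\ldots,tr\frac{a}{\gamma_{q/2-1}})$, $c_2(a)=(tr\frac{a}{\gamma_1},\ldots,tr\frac{a}{\gamma_{q/2-1}})$, $c_3(a)=(tr\frac{a}{b+\gamma_0},\ldots,tr\frac{a}{b+\gamma_{q/2-1}},tr\frac{a}{b+\gamma_0},\ldots,tr\frac{a}{b+\gamma_{q/2-1}})$, $c_4(a)=(tr\frac{a}{b+\gamma_0},\ldots,tr\frac{a}{b+\gamma_{q/2-1}})$ are (a) $w(c_1(a))=\frac12(q-1-K(\lambda;a))$, (b) $w(c_2(a))=\frac14(q-1-K(\lambda;a))$, (c) $w(c_3(a))=\frac12(q+1+K(\lambda;a))$, (d) $w(c_4(a))=\frac14(q+1+K(\lambda;a))$.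
   Context: $q=2^r$, $\mathbb{F}_q$ the field with $q$ elements, $tr(x)=x+x^2+\cdots+x^{2^{r-1}}$ the trace $\mathbb{F}_q\to\mathbb{F}_2$, $\lambda(x)=(-1)^{tr(x)}$, and $K(\lambda;a)=\sum_{\alpha\in\mathbb{F}_q^*}\lambda(\alpha+a\alpha^{ -1})$. Fix $b\in\mathbb{F}_q$ with $tr(b)=1$ and an ordering $\gamma_0=0,\gamma_1,\ldots,\gamma_{q/2-1}$ of $\{\beta\in\mathbb{F}_q:tr\beta=0\}=\{\alpha^2+\alpha:\alpha\in\mathbb{F}_q\}$. Values of $tr$ are regarded as elements $0,1$ of $\mathbb{F}_2$, and $w(\cdot)$ denotes Hamming weight. -}

module Defs where

open import Level using (0ℓ)
open import Data.Nat as ℕ using (ℕ; zero; suc; _^_)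
open import Data.Integer as ℤ using (ℤ)
open import Data.Bool using (Bool; true; false; if_then_else_)
open import Data.List using (List; []; _∷_; length; map; filter; foldr; _++_)
open import Data.List.Membership.Propositional using (_∈_)
open import Data.List.Relation.Unary.Unique.Propositional using (Unique)
open import Relation.Nullary using (¬_; does)
open import Relation.Nullary.Decidable using (¬?)
open import Relation.Binary.PropositionalEquality using (_≡_)
open import Relation.Binary.Definitions using (DecidableEquality)
open import Algebra.Structures using (IsCommutativeRing)

record GF2^ (r : ℕ) : Set₁ where
  field
    Carrier  : Set
    _+_ _*_  : Carrier → Carrier → Carrier
    -_       : Carrier → Carrier
    0# 1#    : Carrier
    isCommutativeRing : IsCommutativeRing _≡_ _+_ _*_ -_ 0# 1#
    _⁻¹      : Carrier → Carrier     -- total; value at 0# is irrelevant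
    ⁻¹-inverse : ∀ x → ¬ (x ≡ 0#) → x * (x ⁻¹) ≡ 1#
    0≢1      : ¬ (0# ≡ 1#)
    _≟_      : DecidableEquality Carrier
    char2    : 1# + 1# ≡ 0#
    elements : List Carrier
    elements-unique   : Unique elements
    elements-complete : ∀ x → x ∈ elements
    card     : length elements ≡ 2 ^ r

  infixl 6 _+_
  infixl 7 _*_

  _/_ : Carrier → Carrier → Carrier
  x / y = x * (y ⁻¹)

  frob : ℕ → Carrier → Carrier
  frob zero    x = x
  frob (suc i) x = let y = frob i x in y * y

  trAux : ℕ → Carrier → Carrier
  trAux zero    x = 0#
  trAux (suc i) x = trAux i x + frob i x

  tr : Carrier → Carrier
  tr = trAux r

  trBit : Carrier → Bool
  trBit x = does (tr x ≟ 1#)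

  λχ : Carrier → ℤ
  λχ x = if trBit x then ℤ.-[1+ 0 ] else ℤ.+ 1

  nonzero : List Carrier
  nonzero = filter (λ x → ¬? (x ≟ 0#)) elements

  K : Carrier → ℤ
  K a = foldr ℤ._+_ (ℤ.+ 0) (map (λ α → λχ (α + a / α)) nonzero)

w : List Bool → ℕ
w [] = 0
w (true ∷ v) = suc (w v)
w (false ∷ v) = w v

module _ {r : ℕ} (F : GF2^ r) where
  open GF2^ F

  -- c_2(a) = (tr(a/γ_1), ..., tr(a/γ_{q/2-1}))  given γ's = γ_1 ... γ_{q/2-1}
  c₂ : Carrier → List Carrier → List Bool
  c₂ a γs = map (λ γ → trBit (a / γ)) γs

  c₁ : Carrier → List Carrier → List Bool
  c₁ a γs = c₂ a γs ++ c₂ a γs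

  -- c_4(a) = (tr(a/(b+γ_0)), ..., tr(a/(b+γ_{q/2-1})))  given γ's = γ_0 ... γ_{q/2-1}
  c₄ : Carrier → Carrier → List Carrier → List Bool
  c₄ a b γs = map (λ γ → trBit (a / (b + γ))) γs

  c₃ : Carrier → Carrier → List Carrier → List Bool
  c₃ a b γs = c₄ a b γs ++ c₄ a b γs

module Submission where

-- Write λ(x) = (-1)^{tr x}.  Since tr is additive with values in F₂, λ is a
-- character: λ(x + a/x) = λ(x) λ(a/x).  The nonzero elements split into the
-- trace-0 class γ₁ … γ_{q/2-1} and the trace-1 class b + γ₀ … b + γ_{q/2-1}.
-- Writing S₀ = Σ_γ λ(a/γ) and S₁ = Σ_γ λ(a/(b+γ)) this gives
--   (1) K(λ;a) = S₀ − S₁,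
--   (2) S₀ + S₁ = Σ_{x≠0} λ(a/x) = Σ_{x≠0} λ(x) = (q/2 − 1) − q/2 = −1,
--       because x ↦ a/x permutes the nonzero elements,
--   (3) S₀ = (q/2 − 1) − 2 w(c₂(a)) and S₁ = q/2 − 2 w(c₄(a)),
-- and the four formulas are linear consequences of (1)–(3).

open import Defs
open import Level using (0ℓ)
open import Data.Nat as ℕ using (ℕ; zero; suc; _^_)
import Data.Nat.Properties as ℕP
open import Data.Integer as ℤ using (ℤ)
import Data.Integer.Properties as ℤP
open import Data.Integer.Tactic.RingSolver using (solve-∀; solve)
open import Data.Bool using (Bool; true; false; _xor_; if_then_else_)
open import Data.Empty using (⊥-elim)
open import Data.Sum using (_⊎_; inj₁; inj₂)
open import Data.Product using (_×_; _,_; proj₂)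
open import Data.List using (List; []; _∷_; length; map; foldr; _++_)
open import Data.List.Properties using (map-∘; map-id; map-cong-local; length-++; length-map)
open import Data.List.Membership.Propositional using (_∈_)
import Data.List.Membership.Propositional.Properties as ∈
open import Data.List.Membership.Propositional.Properties.WithK using (unique∧set⇒bag)
open import Data.List.Relation.Binary.BagAndSetEquality using (∼bag⇒↭)
open import Data.List.Relation.Binary.Permutation.Propositional using (_↭_; ↭⇒↭ₛ)
import Data.List.Relation.Binary.Permutation.Propositional.Properties as ↭
import Data.List.Relation.Binary.Permutation.Setoid.Properties as ↭ₛ
open import Data.List.Relation.Unary.Any using (here; there)
import Data.List.Relation.Unary.All as All
import Data.List.Relation.Unary.AllPairs as AllPairs
open AllPairs using (_∷_)
open import Data.List.Relation.Unary.Unique.Propositional using (Unique)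
import Data.List.Relation.Unary.Unique.Propositional.Properties as Unique
open import Function using (_∘_)
open import Function.Bundles using (_⇔_; mk⇔; Equivalence)
open import Relation.Nullary using (¬_; yes; no)
open import Relation.Nullary.Decidable using (¬?; dec-true; dec-false)
open import Relation.Binary.PropositionalEquality
open import Algebra.Bundles using (CommutativeRing)
open import Algebra.Structures using (IsCommutativeRing)
import Algebra.Properties.CommutativeSemigroup as CommutativeSemigroup
import Algebra.Properties.CommutativeSemiring.Exp as Exp

same-members⇒↭ : {A : Set} {xs ys : List A} → Unique xs → Unique ys →
                 (∀ {x} → x ∈ xs ⇔ x ∈ ys) → xs ↭ ys
same-members⇒↭ xs! ys! same = ∼bag⇒↭ (unique∧set⇒bag xs! ys! same)

invertible-map-permutes : {A : Set} {xs : List A} (σ τ : A → A) → Unique xs →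
  (∀ {x} → x ∈ xs → σ x ∈ xs) → (∀ {x} → x ∈ xs → τ x ∈ xs) →
  (∀ {x} → x ∈ xs → τ (σ x) ≡ x) → (∀ {x} → x ∈ xs → σ (τ x) ≡ x) →
  map σ xs ↭ xs
invertible-map-permutes {xs = xs} σ τ xs! σ∈ τ∈ τσ≡id στ≡id =
  same-members⇒↭ σxs! xs! (mk⇔ to from)
  where
  τσxs≡xs : map τ (map σ xs) ≡ xs
  τσxs≡xs = trans (sym (map-∘ xs)) (trans (map-cong-local (All.tabulate τσ≡id)) (map-id xs))
  σxs! : Unique (map σ xs)
  σxs! = Unique.map⁻ (subst Unique (sym τσxs≡xs) xs!)
  to : ∀ {y} → y ∈ map σ xs → y ∈ xs
  to y∈ with ∈.∈-map⁻ σ y∈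
  ... | x , x∈ , refl = σ∈ x∈
  from : ∀ {y} → y ∈ xs → y ∈ map σ xs
  from y∈ = subst (_∈ map σ xs) (στ≡id y∈) (∈.∈-map⁺ σ (τ∈ y∈))

module IntegerSums where
  open import Data.Integer using (+_; -[1+_]; _+_; _-_; _*_)

  ∑ : {A : Set} → List A → (A → ℤ) → ℤ
  ∑ xs f = foldr _+_ (+ 0) (map f xs)

  module _ {A : Set} where

    ∑-↭ : {xs ys : List A} (f : A → ℤ) → xs ↭ ys → ∑ xs f ≡ ∑ ys f
    ∑-↭ f xs↭ys = ↭ₛ.foldr-commMonoid (setoid ℤ) ℤP.+-0-isCommutativeMonoid
                    (↭⇒↭ₛ (↭.map⁺ f xs↭ys))

    ∑-map : {B : Set} (g : B → A) (xs : List B) (f : A → ℤ) → ∑ (map g xs) f ≡ ∑ xs (f ∘ g)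
    ∑-map g xs f = cong (foldr _+_ (+ 0)) (sym (map-∘ xs))

    ∑-cong : (xs : List A) {f g : A → ℤ} → (∀ {x} → x ∈ xs → f x ≡ g x) → ∑ xs f ≡ ∑ xs g
    ∑-cong xs f≡g = cong (foldr _+_ (+ 0)) (map-cong-local (All.tabulate f≡g))

    ∑-++ : (xs ys : List A) (f : A → ℤ) → ∑ (xs ++ ys) f ≡ ∑ xs f + ∑ ys f
    ∑-++ []       ys f = sym (ℤP.+-identityˡ _)
    ∑-++ (x ∷ xs) ys f = trans (cong (λ t → f x + t) (∑-++ xs ys f)) (sym (ℤP.+-assoc (f x) _ _))

    ∑-factor : (xs : List A) {u : A → ℤ} (c : ℤ) (g : A → ℤ) → (∀ {x} → x ∈ xs → u x ≡ c) →
               ∑ xs (λ x → u x * g x) ≡ c * ∑ xs g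
    ∑-factor []       c g u≡c = sym (ℤP.*-zeroʳ c)
    ∑-factor (x ∷ xs) {u} c g u≡c = begin
      u x * g x + ∑ xs (λ y → u y * g y)  ≡⟨ cong₂ _+_ (cong (_* g x) (u≡c (here refl)))
                                                         (∑-factor xs c g (u≡c ∘ there)) ⟩
      c * g x + c * ∑ xs g                 ≡⟨ sym (ℤP.*-distribˡ-+ c (g x) _) ⟩
      c * ∑ (x ∷ xs) g                     ∎
      where open ≡-Reasoning

    ∑-const : (xs : List A) {u : A → ℤ} (c : ℤ) → (∀ {x} → x ∈ xs → u x ≡ c) →
              ∑ xs u ≡ c * + length xs
    ∑-const []       c u≡c = sym (ℤP.*-zeroʳ c)
    ∑-const (x ∷ xs) c u≡c =
      trans (cong₂ _+_ (u≡c (here refl)) (∑-const xs c (u≡c ∘ there))) (step c (+ length xs))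
      where
      step : ∀ c n → c + c * n ≡ c * (+ 1 + n)
      step = solve-∀

  sign : Bool → ℤ
  sign s = if s then -[1+ 0 ] else + 1

  sign-xor : ∀ s t → sign (s xor t) ≡ sign s * sign t
  sign-xor false false = refl
  sign-xor false true  = refl
  sign-xor true  false = refl
  sign-xor true  true  = refl

  w-++ : ∀ xs ys → w (xs ++ ys) ≡ w xs ℕ.+ w ys
  w-++ []           ys = refl
  w-++ (true  ∷ xs) ys = cong suc (w-++ xs ys)
  w-++ (false ∷ xs) ys = w-++ xs ys

  -- Σ (-1)^{f x} = #{f x = 0} − #{f x = 1} = length − 2 · weight.
  ∑-sign : {A : Set} (f : A → Bool) (xs : List A) →
           ∑ xs (sign ∘ f) ≡ + length xs - + 2 * + w (map f xs)
  ∑-sign f []       = refl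
  ∑-sign f (x ∷ xs) with f x
  ... | true  = trans (cong (λ t → -[1+ 0 ] + t) (∑-sign f xs)) (step (+ length xs) (+ w (map f xs)))
    where
    step : ∀ n k → -[1+ 0 ] + (n - + 2 * k) ≡ (+ 1 + n) - + 2 * (+ 1 + k)
    step = solve-∀
  ... | false = trans (cong (λ t → + 1 + t) (∑-sign f xs)) (step (+ length xs) (+ w (map f xs)))
    where
    step : ∀ n k → + 1 + (n - + 2 * k) ≡ (+ 1 + n) - + 2 * k
    step = solve-∀

open IntegerSums

module FiniteField {r : ℕ} (F : GF2^ r) where
  open GF2^ F
  open IsCommutativeRing isCommutativeRing
    using (+-assoc; +-identityˡ; +-identityʳ; *-assoc; *-comm; *-identityˡ; *-identityʳ;
           distribˡ; distribʳ; zeroˡ; zeroʳ; *-isCommutativeMonoid)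
  open ≡-Reasoning

  ring : CommutativeRing 0ℓ 0ℓ
  ring = record { isCommutativeRing = isCommutativeRing }

  module + = CommutativeSemigroup (CommutativeRing.+-commutativeSemigroup ring)
  module * = CommutativeSemigroup (CommutativeRing.*-commutativeSemigroup ring)
  open Exp (CommutativeRing.commutativeSemiring ring)
    using () renaming (_^_ to _^ᶠ_; ^-homo-* to ^ᶠ-homo-*)

  x+x≡0 : ∀ x → x + x ≡ 0#
  x+x≡0 x = begin
    x + x           ≡⟨ sym (cong₂ _+_ (*-identityˡ x) (*-identityˡ x)) ⟩
    1# * x + 1# * x ≡⟨ sym (distribʳ x 1# 1#) ⟩
    (1# + 1#) * x   ≡⟨ cong (_* x) char2 ⟩
    0# * x          ≡⟨ zeroˡ x ⟩
    0#              ∎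

  +-involutive : ∀ b x → b + (b + x) ≡ x
  +-involutive b x = begin
    b + (b + x)  ≡⟨ sym (+-assoc b b x) ⟩
    b + b + x    ≡⟨ cong (_+ x) (x+x≡0 b) ⟩
    0# + x       ≡⟨ +-identityˡ x ⟩
    x            ∎

  +-cancelˡ : ∀ b {x y} → b + x ≡ b + y → x ≡ y
  +-cancelˡ b {x} {y} eq = begin
    x            ≡⟨ sym (+-involutive b x) ⟩
    b + (b + x)  ≡⟨ cong (b +_) eq ⟩
    b + (b + y)  ≡⟨ +-involutive b y ⟩
    y            ∎

  square-+ : ∀ x y → (x + y) * (x + y) ≡ x * x + y * y
  square-+ x y = begin
    (x + y) * (x + y)                   ≡⟨ distribʳ (x + y) x y ⟩
    x * (x + y) + y * (x + y)           ≡⟨ cong₂ _+_ (distribˡ x x y) (distribˡ y x y) ⟩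
    (x * x + x * y) + (y * x + y * y)   ≡⟨ +-assoc (x * x) (x * y) _ ⟩
    x * x + (x * y + (y * x + y * y))   ≡⟨ cong (x * x +_) (sym (+-assoc (x * y) (y * x) _)) ⟩
    x * x + ((x * y + y * x) + y * y)   ≡⟨ cong (λ t → x * x + (x * y + t + y * y)) (*-comm y x) ⟩
    x * x + ((x * y + x * y) + y * y)   ≡⟨ cong (λ t → x * x + (t + y * y)) (x+x≡0 (x * y)) ⟩
    x * x + (0# + y * y)                ≡⟨ cong (x * x +_) (+-identityˡ (y * y)) ⟩
    x * x + y * y                       ∎

  additive⇒0 : (f : Carrier → Carrier) → (∀ x y → f (x + y) ≡ f x + f y) → f 0# ≡ 0#
  additive⇒0 f f-+ = begin
    f 0#          ≡⟨ cong f (sym (+-identityʳ 0#)) ⟩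
    f (0# + 0#)   ≡⟨ f-+ 0# 0# ⟩
    f 0# + f 0#   ≡⟨ x+x≡0 (f 0#) ⟩
    0#            ∎

  ⁻¹-cancelʳ : ∀ {x} y → x ≢ 0# → x * (x ⁻¹ * y) ≡ y
  ⁻¹-cancelʳ {x} y x≢0 = begin
    x * (x ⁻¹ * y)  ≡⟨ sym (*-assoc x (x ⁻¹) y) ⟩
    x * x ⁻¹ * y    ≡⟨ cong (_* y) (⁻¹-inverse x x≢0) ⟩
    1# * y          ≡⟨ *-identityˡ y ⟩
    y               ∎

  ⁻¹-cancelˡ : ∀ {x} y → x ≢ 0# → x ⁻¹ * (x * y) ≡ y
  ⁻¹-cancelˡ {x} y x≢0 = trans (*.x∙yz≈y∙xz (x ⁻¹) x y) (⁻¹-cancelʳ y x≢0)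

  *-cancelˡ : ∀ {x y z} → x ≢ 0# → x * y ≡ x * z → y ≡ z
  *-cancelˡ {x} {y} {z} x≢0 eq = begin
    y               ≡⟨ sym (⁻¹-cancelˡ y x≢0) ⟩
    x ⁻¹ * (x * y)  ≡⟨ cong (x ⁻¹ *_) eq ⟩
    x ⁻¹ * (x * z)  ≡⟨ ⁻¹-cancelˡ z x≢0 ⟩
    z               ∎

  *-nonzero : ∀ {x y} → x ≢ 0# → y ≢ 0# → x * y ≢ 0#
  *-nonzero {x} {y} x≢0 y≢0 xy≡0 = y≢0 (*-cancelˡ x≢0 (trans xy≡0 (sym (zeroʳ x))))

  ⁻¹-nonzero : ∀ {x} → x ≢ 0# → x ⁻¹ ≢ 0#
  ⁻¹-nonzero {x} x≢0 x⁻¹≡0 = 0≢1 (begin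
    0#         ≡⟨ sym (zeroʳ x) ⟩
    x * 0#     ≡⟨ cong (x *_) (sym x⁻¹≡0) ⟩
    x * x ⁻¹   ≡⟨ ⁻¹-inverse x x≢0 ⟩
    1#         ∎)

  /-nonzero : ∀ {a x} → a ≢ 0# → x ≢ 0# → a / x ≢ 0#
  /-nonzero a≢0 x≢0 = *-nonzero a≢0 (⁻¹-nonzero x≢0)

  /-involutive : ∀ {a x} → a ≢ 0# → x ≢ 0# → a / (a / x) ≡ x
  /-involutive {a} {x} a≢0 x≢0 = *-cancelˡ (/-nonzero a≢0 x≢0) (begin
    (a / x) * (a * (a / x) ⁻¹)  ≡⟨ cong ((a / x) *_) (*-comm a _) ⟩
    (a / x) * ((a / x) ⁻¹ * a)  ≡⟨ ⁻¹-cancelʳ a (/-nonzero a≢0 x≢0) ⟩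
    a                           ≡⟨ sym (⁻¹-cancelʳ a x≢0) ⟩
    x * (x ⁻¹ * a)              ≡⟨ cong (x *_) (*-comm _ a) ⟩
    x * (a / x)                 ≡⟨ *-comm x _ ⟩
    (a / x) * x                 ∎)

  nonzero⁺ : ∀ {x} → x ≢ 0# → x ∈ nonzero
  nonzero⁺ {x} x≢0 = ∈.∈-filter⁺ (λ y → ¬? (y ≟ 0#)) (elements-complete x) x≢0

  nonzero⁻ : ∀ {x} → x ∈ nonzero → x ≢ 0#
  nonzero⁻ x∈ = proj₂ (∈.∈-filter⁻ (λ y → ¬? (y ≟ 0#)) {xs = elements} x∈)

  nonzero-unique : Unique nonzero
  nonzero-unique = Unique.filter⁺ (λ y → ¬? (y ≟ 0#)) elements-unique

  elements↭0∷nonzero : elements ↭ 0# ∷ nonzero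
  elements↭0∷nonzero = same-members⇒↭ elements-unique
    (All.tabulate (λ x∈ 0≡x → nonzero⁻ x∈ (sym 0≡x)) ∷ nonzero-unique)
    (λ {x} → mk⇔ (λ _ → split x) (λ _ → elements-complete x))
    where
    split : ∀ x → x ∈ 0# ∷ nonzero
    split x with x ≟ 0#
    ... | yes x≡0 = here x≡0
    ... | no  x≢0 = there (nonzero⁺ x≢0)

  order : 2 ^ r ≡ suc (length nonzero)
  order = trans (sym card) (↭.↭-length elements↭0∷nonzero)

  *-permutes : ∀ {c} → c ≢ 0# → map (c *_) nonzero ↭ nonzero
  *-permutes c≢0 = invertible-map-permutes _ _ nonzero-unique
    (λ x∈ → nonzero⁺ (*-nonzero c≢0 (nonzero⁻ x∈)))
    (λ x∈ → nonzero⁺ (*-nonzero (⁻¹-nonzero c≢0) (nonzero⁻ x∈)))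
    (λ {x} _ → ⁻¹-cancelˡ x c≢0) (λ {x} _ → ⁻¹-cancelʳ x c≢0)

  /-permutes : ∀ {a} → a ≢ 0# → map (a /_) nonzero ↭ nonzero
  /-permutes a≢0 = invertible-map-permutes _ _ nonzero-unique
    (λ x∈ → nonzero⁺ (/-nonzero a≢0 (nonzero⁻ x∈))) (λ x∈ → nonzero⁺ (/-nonzero a≢0 (nonzero⁻ x∈)))
    (λ x∈ → /-involutive a≢0 (nonzero⁻ x∈)) (λ x∈ → /-involutive a≢0 (nonzero⁻ x∈))

  ∏ : List Carrier → Carrier
  ∏ = foldr _*_ 1#

  ∏-↭ : ∀ {xs ys} → xs ↭ ys → ∏ xs ≡ ∏ ys
  ∏-↭ xs↭ys = ↭ₛ.foldr-commMonoid (setoid Carrier) *-isCommutativeMonoid (↭⇒↭ₛ xs↭ys)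

  ∏-nonzero : ∀ xs → (∀ {x} → x ∈ xs → x ≢ 0#) → ∏ xs ≢ 0#
  ∏-nonzero []       _     1≡0 = 0≢1 (sym 1≡0)
  ∏-nonzero (x ∷ xs) xs≢0 = *-nonzero (xs≢0 (here refl)) (∏-nonzero xs (xs≢0 ∘ there))

  ∏-scale : ∀ c xs → ∏ (map (c *_) xs) ≡ c ^ᶠ length xs * ∏ xs
  ∏-scale c []       = sym (*-identityˡ 1#)
  ∏-scale c (x ∷ xs) = begin
    c * x * ∏ (map (c *_) xs)            ≡⟨ cong (c * x *_) (∏-scale c xs) ⟩
    c * x * (c ^ᶠ length xs * ∏ xs)      ≡⟨ *.interchange c x _ _ ⟩
    c * c ^ᶠ length xs * (x * ∏ xs)      ∎

  -- Fermat's little theorem: x^q = x.  For x ≠ 0, comparing the products of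
  -- the nonzero elements and of their multiples by x gives x^{q-1} = 1.
  unit-power : ∀ {x} → x ≢ 0# → x ^ᶠ length nonzero ≡ 1#
  unit-power {x} x≢0 = *-cancelˡ (∏-nonzero nonzero nonzero⁻) (begin
    ∏ nonzero * x ^ᶠ length nonzero  ≡⟨ *-comm _ _ ⟩
    x ^ᶠ length nonzero * ∏ nonzero  ≡⟨ sym (∏-scale x nonzero) ⟩
    ∏ (map (x *_) nonzero)           ≡⟨ ∏-↭ (*-permutes x≢0) ⟩
    ∏ nonzero                        ≡⟨ sym (*-identityʳ _) ⟩
    ∏ nonzero * 1#                   ∎)

  fermat : ∀ x → x ^ᶠ (2 ^ r) ≡ x
  fermat x rewrite order with x ≟ 0#
  ... | yes refl = zeroˡ _
  ... | no  x≢0  = trans (cong (x *_) (unit-power x≢0)) (*-identityʳ x)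

  frob≡power : ∀ i x → frob i x ≡ x ^ᶠ (2 ^ i)
  frob≡power zero    x = sym (*-identityʳ x)
  frob≡power (suc i) x = begin
    frob i x * frob i x                ≡⟨ cong₂ _*_ (frob≡power i x) (frob≡power i x) ⟩
    x ^ᶠ (2 ^ i) * x ^ᶠ (2 ^ i)         ≡⟨ sym (^ᶠ-homo-* x (2 ^ i) (2 ^ i)) ⟩
    x ^ᶠ (2 ^ i ℕ.+ 2 ^ i)              ≡⟨ cong (λ n → x ^ᶠ (2 ^ i ℕ.+ n)) (sym (ℕP.+-identityʳ (2 ^ i))) ⟩
    x ^ᶠ (2 ^ suc i)                   ∎

  frob-r : ∀ x → frob r x ≡ x
  frob-r x = trans (frob≡power r x) (fermat x)

  frob-+ : ∀ i x y → frob i (x + y) ≡ frob i x + frob i y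
  frob-+ zero    x y = refl
  frob-+ (suc i) x y = trans (cong (λ t → t * t) (frob-+ i x y)) (square-+ _ _)

  frob-square : ∀ i x → frob i (x * x) ≡ frob i x * frob i x
  frob-square zero    x = refl
  frob-square (suc i) x = cong (λ t → t * t) (frob-square i x)

  trAux-+ : ∀ i x y → trAux i (x + y) ≡ trAux i x + trAux i y
  trAux-+ zero    x y = sym (+-identityˡ 0#)
  trAux-+ (suc i) x y =
    trans (cong₂ _+_ (trAux-+ i x y) (frob-+ i x y)) (+.interchange _ _ _ _)

  tr-+ : ∀ x y → tr (x + y) ≡ tr x + tr y
  tr-+ = trAux-+ r

  tr-0 : tr 0# ≡ 0#
  tr-0 = additive⇒0 tr tr-+

  -- tr(x)² = tr(x²) and tr(x²) = tr(x), by telescoping x + tr(x²) = x^q + tr(x).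
  trAux-square : ∀ i x → trAux i x * trAux i x ≡ trAux i (x * x)
  trAux-square zero    x = zeroˡ 0#
  trAux-square (suc i) x =
    trans (square-+ _ _) (cong₂ _+_ (trAux-square i x) (sym (frob-square i x)))

  trAux-telescope : ∀ i x → x + trAux i (x * x) ≡ frob i x + trAux i x
  trAux-telescope zero    x = refl
  trAux-telescope (suc i) x = begin
    x + (trAux i (x * x) + frob i (x * x))          ≡⟨ sym (+-assoc x _ _) ⟩
    x + trAux i (x * x) + frob i (x * x)            ≡⟨ cong₂ _+_ (trAux-telescope i x) (frob-square i x) ⟩
    frob i x + trAux i x + frob i x * frob i x      ≡⟨ +.xy∙z≈z∙yx _ _ _ ⟩
    frob i x * frob i x + (trAux i x + frob i x)    ∎

  tr-idempotent : ∀ x → tr x * tr x ≡ tr x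
  tr-idempotent x = +-cancelˡ x (begin
    x + tr x * tr x     ≡⟨ cong (x +_) (trAux-square r x) ⟩
    x + tr (x * x)      ≡⟨ trAux-telescope r x ⟩
    frob r x + tr x     ≡⟨ cong (_+ tr x) (frob-r x) ⟩
    x + tr x            ∎)

  -- The trace takes values in F₂ = {0, 1}, as an idempotent of a field is 0 or 1.
  idempotent⇒0∨1 : ∀ t → t * t ≡ t → t ≡ 0# ⊎ t ≡ 1#
  idempotent⇒0∨1 t t²≡t with t ≟ 0#
  ... | yes t≡0 = inj₁ t≡0
  ... | no  t≢0 = inj₂ (*-cancelˡ t≢0 (trans t²≡t (sym (*-identityʳ t))))

  tr-0∨1 : ∀ x → tr x ≡ 0# ⊎ tr x ≡ 1#
  tr-0∨1 x = idempotent⇒0∨1 (tr x) (tr-idempotent x)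

  embed : Bool → Carrier
  embed true  = 1#
  embed false = 0#

  tr-embed : ∀ x → tr x ≡ embed (trBit x)
  tr-embed x with tr x ≟ 1#
  ... | yes tr≡1 = tr≡1
  ... | no  tr≢1 with tr-0∨1 x
  ...   | inj₁ tr≡0 = tr≡0
  ...   | inj₂ tr≡1 = ⊥-elim (tr≢1 tr≡1)

  trBit-embed : ∀ {x} c → tr x ≡ embed c → trBit x ≡ c
  trBit-embed {x} true  tr≡1 = dec-true (tr x ≟ 1#) tr≡1
  trBit-embed {x} false tr≡0 = dec-false (tr x ≟ 1#) (λ tr≡1 → 0≢1 (trans (sym tr≡0) tr≡1))

  embed-xor : ∀ s t → embed s + embed t ≡ embed (s xor t)
  embed-xor false t     = +-identityˡ (embed t)
  embed-xor true  false = +-identityʳ 1#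
  embed-xor true  true  = char2

  trBit-+ : ∀ x y → trBit (x + y) ≡ trBit x xor trBit y
  trBit-+ x y = trBit-embed (trBit x xor trBit y) (begin
    tr (x + y)                        ≡⟨ tr-+ x y ⟩
    tr x + tr y                       ≡⟨ cong₂ _+_ (tr-embed x) (tr-embed y) ⟩
    embed (trBit x) + embed (trBit y) ≡⟨ embed-xor (trBit x) (trBit y) ⟩
    embed (trBit x xor trBit y)       ∎)

  λχ-+ : ∀ x y → λχ (x + y) ≡ λχ x ℤ.* λχ y
  λχ-+ x y = trans (cong sign (trBit-+ x y)) (sign-xor (trBit x) (trBit y))

  λχ-embed : ∀ {x} c → tr x ≡ embed c → λχ x ≡ sign c
  λχ-embed c tr≡c = cong sign (trBit-embed c tr≡c)

module CharacterSums {r : ℕ} (F : GF2^ r) where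
  open GF2^ F
  open FiniteField F
  open IsCommutativeRing isCommutativeRing using (+-identityʳ)

  module TraceClasses (b : Carrier) (tr-b : tr b ≡ 1#) (γs : List Carrier) (0γs! : Unique (0# ∷ γs))
                      (γs-trace0 : ∀ β → (β ∈ (0# ∷ γs)) ⇔ (tr β ≡ 0#)) where

    T₁ : List Carrier
    T₁ = map (b +_) (0# ∷ γs)

    tr-b+ : ∀ x → tr (b + x) ≡ 1# + tr x
    tr-b+ x = trans (tr-+ b x) (cong (_+ tr x) tr-b)

    γs⇒tr0 : ∀ {x} → x ∈ γs → tr x ≡ 0#
    γs⇒tr0 x∈ = Equivalence.to (γs-trace0 _) (there x∈)

    T₁⇒tr1 : ∀ {x} → x ∈ T₁ → tr x ≡ 1#
    T₁⇒tr1 x∈ with ∈.∈-map⁻ (b +_) x∈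
    ... | γ , γ∈ , refl =
      trans (tr-b+ γ) (trans (cong (1# +_) (Equivalence.to (γs-trace0 γ) γ∈)) (+-identityʳ 1#))

    trace-partition : nonzero ↭ γs ++ T₁
    trace-partition = same-members⇒↭ nonzero-unique γs++T₁! (mk⇔ to from)
      where
      γs++T₁! : Unique (γs ++ T₁)
      γs++T₁! = Unique.++⁺ (AllPairs.tail 0γs!) (Unique.map⁺ (+-cancelˡ b) 0γs!)
        (λ (x∈γs , x∈T₁) → 0≢1 (trans (sym (γs⇒tr0 x∈γs)) (T₁⇒tr1 x∈T₁)))

      to : ∀ {x} → x ∈ nonzero → x ∈ γs ++ T₁
      to {x} x∈ with tr-0∨1 x
      ... | inj₁ tr≡0 with Equivalence.from (γs-trace0 x) tr≡0
      ...   | here x≡0    = ⊥-elim (nonzero⁻ x∈ x≡0)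
      ...   | there x∈γs  = ∈.∈-++⁺ˡ x∈γs
      to {x} x∈ | inj₂ tr≡1 = ∈.∈-++⁺ʳ γs (subst (_∈ T₁) (+-involutive b x)
        (∈.∈-map⁺ (b +_) (Equivalence.from (γs-trace0 (b + x))
          (trans (tr-b+ x) (trans (cong (1# +_) tr≡1) char2)))))

      from : ∀ {x} → x ∈ γs ++ T₁ → x ∈ nonzero
      from x∈ with ∈.∈-++⁻ γs x∈
      ... | inj₁ x∈γs = nonzero⁺ (λ x≡0 → All.lookup (AllPairs.head 0γs!) x∈γs (sym x≡0))
      ... | inj₂ x∈T₁ = nonzero⁺ (λ x≡0 → 0≢1 (begin
        0#      ≡⟨ sym tr-0 ⟩
        tr 0#   ≡⟨ cong tr (sym x≡0) ⟩
        tr _    ≡⟨ T₁⇒tr1 x∈T₁ ⟩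
        1#      ∎))
        where open ≡-Reasoning

    order-γs : 2 ^ r ≡ suc (length γs ℕ.+ suc (length γs))
    order-γs = begin
      2 ^ r                               ≡⟨ order ⟩
      suc (length nonzero)                ≡⟨ cong suc (↭.↭-length trace-partition) ⟩
      suc (length (γs ++ T₁))             ≡⟨ cong suc (length-++ γs) ⟩
      suc (length γs ℕ.+ length T₁)       ≡⟨ cong (λ n → suc (length γs ℕ.+ n)) (length-map (b +_) (0# ∷ γs)) ⟩
      suc (length γs ℕ.+ suc (length γs)) ∎
      where open ≡-Reasoning

    S₀ S₁ : Carrier → ℤ
    S₀ a = ∑ γs (λ x → λχ (a / x))
    S₁ a = ∑ T₁ (λ x → λχ (a / x))

    -- (1) K(λ;a) = Σ λ(x) λ(a/x) = S₀ − S₁, as λ(x) = ±1 according to the trace class.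
    K-split : ∀ a → K a ≡ ℤ.+ 1 ℤ.* S₀ a ℤ.+ ℤ.-[1+ 0 ] ℤ.* S₁ a
    K-split a = begin
      K a                                               ≡⟨ ∑-cong nonzero {f = λ x → λχ (x + a / x)} (λ {x} _ → λχ-+ x (a / x)) ⟩
      ∑ nonzero (λ x → λχ x ℤ.* λχ (a / x))             ≡⟨ ∑-↭ _ trace-partition ⟩
      ∑ (γs ++ T₁) (λ x → λχ x ℤ.* λχ (a / x))          ≡⟨ ∑-++ γs T₁ _ ⟩
      ∑ γs (λ x → λχ x ℤ.* λχ (a / x))
        ℤ.+ ∑ T₁ (λ x → λχ x ℤ.* λχ (a / x))            ≡⟨ cong₂ ℤ._+_
                                                              (∑-factor γs _ _ (λ x∈ → λχ-embed false (γs⇒tr0 x∈)))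
                                                              (∑-factor T₁ _ _ (λ x∈ → λχ-embed true (T₁⇒tr1 x∈))) ⟩
      ℤ.+ 1 ℤ.* S₀ a ℤ.+ ℤ.-[1+ 0 ] ℤ.* S₁ a            ∎
      where open ≡-Reasoning

    -- (2) S₀ + S₁ = Σ_{x≠0} λ(a/x) = Σ_{x≠0} λ(x) = |γs| − |T₁|, since x ↦ a/x
    -- permutes the nonzero elements.
    character-sum : ∀ {a} → a ≢ 0# →
      S₀ a ℤ.+ S₁ a ≡ ℤ.+ 1 ℤ.* ℤ.+ length γs ℤ.+ ℤ.-[1+ 0 ] ℤ.* ℤ.+ suc (length γs)
    character-sum {a} a≢0 = begin
      S₀ a ℤ.+ S₁ a                                ≡⟨ sym (∑-++ γs T₁ _) ⟩
      ∑ (γs ++ T₁) (λ x → λχ (a / x))               ≡⟨ sym (∑-↭ _ trace-partition) ⟩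
      ∑ nonzero (λ x → λχ (a / x))                  ≡⟨ sym (∑-map (a /_) nonzero λχ) ⟩
      ∑ (map (a /_) nonzero) λχ                     ≡⟨ ∑-↭ λχ (/-permutes a≢0) ⟩
      ∑ nonzero λχ                                  ≡⟨ ∑-↭ λχ trace-partition ⟩
      ∑ (γs ++ T₁) λχ                               ≡⟨ ∑-++ γs T₁ λχ ⟩
      ∑ γs λχ ℤ.+ ∑ T₁ λχ                           ≡⟨ cong₂ ℤ._+_ (∑-const γs _ (λ x∈ → λχ-embed false (γs⇒tr0 x∈)))
                                                                   (∑-const T₁ _ (λ x∈ → λχ-embed true (T₁⇒tr1 x∈))) ⟩
      ℤ.+ 1 ℤ.* ℤ.+ length γs ℤ.+ ℤ.-[1+ 0 ] ℤ.* ℤ.+ length T₁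
                                                   ≡⟨ cong (λ n → ℤ.+ 1 ℤ.* ℤ.+ length γs ℤ.+ ℤ.-[1+ 0 ] ℤ.* ℤ.+ n)
                                                        (length-map (b +_) (0# ∷ γs)) ⟩
      ℤ.+ 1 ℤ.* ℤ.+ length γs ℤ.+ ℤ.-[1+ 0 ] ℤ.* ℤ.+ suc (length γs) ∎
      where open ≡-Reasoning

    S₀-weight : ∀ a → S₀ a ≡ ℤ.+ length γs ℤ.- ℤ.+ 2 ℤ.* ℤ.+ w (c₂ F a γs)
    S₀-weight a = ∑-sign (λ γ → trBit (a / γ)) γs

    S₁-weight : ∀ a → S₁ a ≡ ℤ.+ suc (length γs) ℤ.- ℤ.+ 2 ℤ.* ℤ.+ w (c₄ F a b (0# ∷ γs))
    S₁-weight a = trans (∑-map (b +_) (0# ∷ γs) (λ x → λχ (a / x))) (∑-sign (λ γ → trBit (a / (b + γ))) (0# ∷ γs))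

module WeightArithmetic where
  open import Data.Integer using (+_; -[1+_]; _+_; _-_; _*_)

  cancel-equal : ∀ {x y u v : ℤ} → u ≡ v → x ≡ y + (u - v) → x ≡ y
  cancel-equal {y = y} {u} refl x≡y+0 =
    trans x≡y+0 (trans (cong (λ t → y + t) (ℤP.+-inverseʳ u)) (ℤP.+-identityʳ y))

  -- Here n = |γs| = q/2 − 1, Q = q, W₂ = w(c₂(a)), W₄ = w(c₄(a)), and W₁, W₃ are
  -- the weights of the doubled codes c₁(a), c₃(a); the hypotheses on K, S₀, S₁
  -- are (1), (3) and (2).
  weight-formulas : ∀ {Q K S₀ S₁ W₁ W₃ : ℤ} (n W₂ W₄ : ℤ) →
    W₁ ≡ W₂ + W₂ → W₃ ≡ W₄ + W₄ →
    Q ≡ + 1 + (n + (+ 1 + n)) →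
    K ≡ + 1 * S₀ + -[1+ 0 ] * S₁ →
    S₀ ≡ n - + 2 * W₂ →
    S₁ ≡ (+ 1 + n) - + 2 * W₄ →
    S₀ + S₁ ≡ + 1 * n + -[1+ 0 ] * (+ 1 + n) →
      (+ 2 * W₁ ≡ Q - + 1 - K) × (+ 4 * W₂ ≡ Q - + 1 - K)
    × (+ 2 * W₃ ≡ Q + + 1 + K) × (+ 4 * W₄ ≡ Q + + 1 + K)
  weight-formulas n W₂ W₄ refl refl refl refl refl refl sum-relation =
      cancel-equal (sym sum-relation) (solve (n ∷ W₂ ∷ W₄ ∷ []))
    , cancel-equal (sym sum-relation) (solve (n ∷ W₂ ∷ W₄ ∷ []))
    , cancel-equal (sym sum-relation) (solve (n ∷ W₂ ∷ W₄ ∷ []))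
    , cancel-equal (sym sum-relation) (solve (n ∷ W₂ ∷ W₄ ∷ []))

open WeightArithmetic

open import Data.Integer using (+_)

lemma6 : (r : ℕ) (F : GF2^ r) →
    let open GF2^ F in
    (b : Carrier) → tr b ≡ 1# →
    (γs : List Carrier) → Unique (0# ∷ γs) →
    (∀ β → (β ∈ (0# ∷ γs)) ⇔ (tr β ≡ 0#)) →
    (a : Carrier) → ¬ (a ≡ 0#) →
    ((+ 2) ℤ.* (+ w (c₁ F a γs)) ≡ (+ (2 ^ r)) ℤ.- (+ 1) ℤ.- K a)
    × ((+ 4) ℤ.* (+ w (c₂ F a γs)) ≡ (+ (2 ^ r)) ℤ.- (+ 1) ℤ.- K a)
    × ((+ 2) ℤ.* (+ w (c₃ F a b (0# ∷ γs))) ≡ (+ (2 ^ r)) ℤ.+ (+ 1) ℤ.+ K a)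
    × ((+ 4) ℤ.* (+ w (c₄ F a b (0# ∷ γs))) ≡ (+ (2 ^ r)) ℤ.+ (+ 1) ℤ.+ K a)
lemma6 r F b tr-b γs 0γs! γs-trace0 a a≢0 =
  weight-formulas (+ length γs) (+ w (c₂ F a γs)) (+ w (c₄ F a b (0# ∷ γs)))
    (cong +_ (w-++ (c₂ F a γs) (c₂ F a γs)))
    (cong +_ (w-++ (c₄ F a b (0# ∷ γs)) (c₄ F a b (0# ∷ γs))))
    (cong +_ order-γs) (K-split a) (S₀-weight a) (S₁-weight a) (character-sum a≢0)
  where
  open GF2^ F using (0#)
  open CharacterSums.TraceClasses F b tr-b γs 0γs! γs-trace0
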